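{- For every positive integer $n$, the Bell number $\mathrm{B}_n$ satisfies \[ \mathrm{B}_n=\sum_{k=1}^n(-1)^{n-k}\Biggl[\sum_{\ell=1}^{k}L(k,\ell)\Biggr]S(n,k), \] where $L(k,\ell)$ denotes the Lah numbers and $S(n,k)$ the Stirling numbers of the second kind.
   Context: The Bell numbers $\mathrm{B}_n$ ($n\ge 0$) are defined by the generating function $e^{e^x-1}=\sum_{k=0}^\infty \frac{\mathrm{B}_k}{k!}x^k$; equivalently, $\mathrm{B}_n$ is the number of partitions of an $n$-element set into nonempty blocks. The Stirling numbers of the second kind are $S(n,k)=\frac1{k!}\sum_{i=0}^k(-1)^i\binom{k}{i}(k-i)^n$, the number of partitions of an $n$-element set into $k$ nonempty blocks. The Lah numbers are $L(n,k)=\binom{n-1}{k-1}\frac{n!}{k!}$ for $n\ge k\ge 1$. -}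

module Defs where

open import Data.Nat as ℕ using (ℕ; zero; suc; _!; _∸_)
open import Data.Nat.Properties using (_!≢0)
open import Data.Nat.Combinatorics using (_C_)
open import Data.Integer as ℤ using (ℤ; +_; -_)
open import Data.Integer.Base using (_/ℕ_)

sgn : ℕ → ℤ
sgn zero = + 1
sgn (suc m) = - sgn m

sumFrom : ℕ → ℕ → (ℕ → ℤ) → ℤ
sumFrom a zero f = + 0
sumFrom a (suc m) f = f a ℤ.+ sumFrom (suc a) m f

-- ΣZ a b f = Σ_{i=a}^{b} f i  (empty if b < a)
ΣZ : ℕ → ℕ → (ℕ → ℤ) → ℤ
ΣZ a b f = sumFrom a (suc b ∸ a) f

S : ℕ → ℕ → ℤ
S n k = _/ℕ_ (ΣZ 0 k (λ i → sgn i ℤ.* (+ ((k C i) ℕ.* ((k ∸ i) ℕ.^ n)))))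
             (k !) {{k !≢0}}

L : ℕ → ℕ → ℕ
L n k = ℕ._/_ (((n ∸ 1) C (k ∸ 1)) ℕ.* (n !)) (k !) {{k !≢0}}

Bell : ℕ → ℤ
Bell n = ΣZ 0 n (λ k → S n k)

-- Substituting −x into x^n = Σₖ S(n,k) x(x−1)⋯(x−k+1) gives x^n = Σₖ (−1)^(n−k) S(n,k) x(x+1)⋯(x+k−1);
-- expanding each rising factorial as Σₗ L(k,l) x(x−1)⋯(x−l+1) and comparing coefficients yields the
-- inversion formula Σₖ (−1)^(n−k) S(n,k) L(k,l) = S(n,l), and summing over l gives the theorem.
-- The inversion formula is proved by induction on n from the recurrences
-- S(n+1,k+1) = S(n,k) + (k+1) S(n,k+1) and L(k+1,l+1) = L(k,l) + (k+l+1) L(k,l+1), which the explicit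
-- formulas satisfy (for S, read k! S(n,k) as the k-th forward difference of x^n at 0).
module Submission where

open import Defs
open import Data.Nat using (ℕ; zero; suc; _∸_; _!; z≤n; s≤s)
open import Data.Integer using (ℤ; +_; _*_; _+_; -_; _-_; 0ℤ; -1ℤ; _/ℕ_)
open import Relation.Binary.PropositionalEquality using (_≡_; refl; sym; trans; cong; cong₂; module ≡-Reasoning)

import Data.Nat as ℕ
import Data.Nat.Properties as ℕₚ
open import Data.Nat.Properties using (_!≢0)
open import Data.Nat.Combinatorics using (_C_; k>n⇒nCk≡0; nC1≡n; nCk+nC[k+1]≡[n+1]C[k+1])
open import Data.Nat.DivMod using (m*n/n≡m)
import Data.Nat.Tactic.RingSolver as ℕ-Solver
open import Data.Integer.Properties
open import Data.Integer.Tactic.RingSolver using (solve-∀)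
open import Data.Fin using (toℕ)
open import Data.Fin.Properties using (toℕ<n; toℕ-inject₁; toℕ-fromℕ)
open import Algebra.Properties.Semiring.Sum +-*-semiring
  using (sum; sum-cong-≗; sum-init-last; sum-replicate-zero; ∑-distrib-+; ∑-comm; *-distribˡ-sum)
open import Function using (_∘_)
open import Data.Sum using (inj₁; inj₂)
open import Algebra.Properties.CommutativeSemigroup *-commutativeSemigroup using (x∙yz≈y∙xz)

open ≡-Reasoning

Σ< : ℕ → (ℕ → ℤ) → ℤ
Σ< n f = sum {n} (f ∘ toℕ)

Σ<-cong : ∀ n {f g : ℕ → ℤ} → (∀ {i} → i ℕ.< n → f i ≡ g i) → Σ< n f ≡ Σ< n g
Σ<-cong n f≡g = sum-cong-≗ (λ i → f≡g {toℕ i} (toℕ<n i))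

Σ<-vanishing : ∀ n {f : ℕ → ℤ} → (∀ i → f i ≡ 0ℤ) → Σ< n f ≡ 0ℤ
Σ<-vanishing n f≡0 = trans (sum-cong-≗ {n} (f≡0 ∘ toℕ)) (sum-replicate-zero n)

Σ<-snoc : ∀ n f → Σ< (suc n) f ≡ Σ< n f + f n
Σ<-snoc n f = trans (sum-init-last {n} (f ∘ toℕ))
  (cong₂ _+_ (sum-cong-≗ {n} (cong f ∘ toℕ-inject₁)) (cong f (toℕ-fromℕ n)))

Σ<-+ : ∀ n f g → Σ< n (λ i → f i + g i) ≡ Σ< n f + Σ< n g
Σ<-+ n f g = ∑-distrib-+ {n} (f ∘ toℕ) (g ∘ toℕ)

Σ<-*ˡ : ∀ n c f → Σ< n (λ i → c * f i) ≡ c * Σ< n f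
Σ<-*ˡ n c f = sym (*-distribˡ-sum {n} c (f ∘ toℕ))

Σ<-neg : ∀ n f → Σ< n (λ i → - f i) ≡ - Σ< n f
Σ<-neg n f = begin
  Σ< n (λ i → - f i)      ≡⟨ sum-cong-≗ {n} (λ i → sym (-1*i≡-i (f (toℕ i)))) ⟩
  Σ< n (λ i → -1ℤ * f i)  ≡⟨ Σ<-*ˡ n -1ℤ f ⟩
  -1ℤ * Σ< n f            ≡⟨ -1*i≡-i (Σ< n f) ⟩
  - Σ< n f                ∎

Σ<-comm : ∀ m n (f : ℕ → ℕ → ℤ) → Σ< m (λ i → Σ< n (f i)) ≡ Σ< n (λ j → Σ< m (λ i → f i j))
Σ<-comm m n f = ∑-comm {m} {n} (λ i j → f (toℕ i) (toℕ j))

Σ<-vanishing-tail : ∀ {m n} f → m ℕ.≤ n → (∀ {i} → m ℕ.≤ i → f i ≡ 0ℤ) → Σ< n f ≡ Σ< m f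
Σ<-vanishing-tail {zero}  {n}     f _         f≡0 = Σ<-vanishing n (λ i → f≡0 {i} z≤n)
Σ<-vanishing-tail {suc m} {suc n} f (s≤s m≤n) f≡0 =
  cong (_+_ (f 0)) (Σ<-vanishing-tail (f ∘ suc) m≤n (λ {i} m≤i → f≡0 {suc i} (s≤s m≤i)))

sumFrom-suc : ∀ a m f → sumFrom (suc a) m f ≡ sumFrom a m (f ∘ suc)
sumFrom-suc a zero    f = refl
sumFrom-suc a (suc m) f = cong (_+_ (f (suc a))) (sumFrom-suc (suc a) m f)

sumFrom-0≡Σ< : ∀ m f → sumFrom 0 m f ≡ Σ< m f
sumFrom-0≡Σ< zero    f = refl
sumFrom-0≡Σ< (suc m) f = cong (_+_ (f 0)) (trans (sumFrom-suc 0 m f) (sumFrom-0≡Σ< m (f ∘ suc)))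

ΣZ-from-0 : ∀ b f → ΣZ 0 b f ≡ Σ< (suc b) f
ΣZ-from-0 b = sumFrom-0≡Σ< (suc b)

ΣZ-from-1 : ∀ b f → ΣZ 1 b f ≡ Σ< b (f ∘ suc)
ΣZ-from-1 b f = trans (sumFrom-suc 0 b f) (sumFrom-0≡Σ< b (f ∘ suc))

sgn-suc-∸ : ∀ {n k} → k ℕ.≤ n → sgn (suc n ∸ k) ≡ - sgn (n ∸ k)
sgn-suc-∸ k≤n = cong sgn (ℕₚ.+-∸-assoc 1 k≤n)

Σ± : ℕ → (ℕ → ℤ) → ℤ
Σ± n f = Σ< (suc n) (λ k → sgn (n ∸ k) * f k)

Σ±-cong : ∀ n {f g : ℕ → ℤ} → (∀ {k} → k ℕ.≤ n → f k ≡ g k) → Σ± n f ≡ Σ± n g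
Σ±-cong n f≡g = Σ<-cong (suc n) (λ {k} k<1+n → cong (sgn (n ∸ k) *_) (f≡g (ℕ.s≤s⁻¹ k<1+n)))

Σ±-+ : ∀ n f g → Σ± n (λ k → f k + g k) ≡ Σ± n f + Σ± n g
Σ±-+ n f g = begin
  Σ< (suc n) (λ k → sgn (n ∸ k) * (f k + g k))
    ≡⟨ sum-cong-≗ {suc n} (λ i → *-distribˡ-+ (sgn (n ∸ toℕ i)) (f (toℕ i)) (g (toℕ i))) ⟩
  Σ< (suc n) (λ k → sgn (n ∸ k) * f k + sgn (n ∸ k) * g k)
    ≡⟨ Σ<-+ (suc n) (λ k → sgn (n ∸ k) * f k) (λ k → sgn (n ∸ k) * g k) ⟩
  Σ± n f + Σ± n g ∎

Σ±-*ˡ : ∀ n c f → Σ± n (λ k → c * f k) ≡ c * Σ± n f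
Σ±-*ˡ n c f = begin
  Σ< (suc n) (λ k → sgn (n ∸ k) * (c * f k))
    ≡⟨ sum-cong-≗ {suc n} (λ i → x∙yz≈y∙xz (sgn (n ∸ toℕ i)) c (f (toℕ i))) ⟩
  Σ< (suc n) (λ k → c * (sgn (n ∸ k) * f k))
    ≡⟨ Σ<-*ˡ (suc n) c (λ k → sgn (n ∸ k) * f k) ⟩
  c * Σ± n f ∎

Σ<-Σ±-comm : ∀ m n (f : ℕ → ℕ → ℤ) → Σ< m (λ l → Σ± n (λ k → f k l)) ≡ Σ± n (λ k → Σ< m (f k))
Σ<-Σ±-comm m n f = begin
  Σ< m (λ l → Σ< (suc n) (λ k → sgn (n ∸ k) * f k l))
    ≡⟨ Σ<-comm m (suc n) (λ l k → sgn (n ∸ k) * f k l) ⟩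
  Σ< (suc n) (λ k → Σ< m (λ l → sgn (n ∸ k) * f k l))
    ≡⟨ sum-cong-≗ {suc n} (λ i → Σ<-*ˡ m (sgn (n ∸ toℕ i)) (f (toℕ i))) ⟩
  Σ± n (λ k → Σ< m (f k)) ∎

Σ±-vanishing-head : ∀ n f → f 0 ≡ 0ℤ → Σ± (suc n) f ≡ Σ± n (f ∘ suc)
Σ±-vanishing-head n f f0≡0 = begin
  sgn (suc n) * f 0 + Σ± n (f ∘ suc)  ≡⟨ cong (λ x → sgn (suc n) * x + Σ± n (f ∘ suc)) f0≡0 ⟩
  sgn (suc n) * 0ℤ + Σ± n (f ∘ suc)   ≡⟨ cong (_+ Σ± n (f ∘ suc)) (*-zeroʳ (sgn (suc n))) ⟩
  0ℤ + Σ± n (f ∘ suc)                 ≡⟨ +-identityˡ (Σ± n (f ∘ suc)) ⟩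
  Σ± n (f ∘ suc)                      ∎

Σ±-vanishing-last : ∀ n f → f (suc n) ≡ 0ℤ → Σ± (suc n) f ≡ - Σ± n f
Σ±-vanishing-last n f f[1+n]≡0 = begin
  Σ± (suc n) f
    ≡⟨ Σ<-snoc (suc n) (λ k → sgn (suc n ∸ k) * f k) ⟩
  Σ< (suc n) (λ k → sgn (suc n ∸ k) * f k) + sgn (n ∸ n) * f (suc n)
    ≡⟨ cong (_+_ (Σ< (suc n) (λ k → sgn (suc n ∸ k) * f k))) last≡0 ⟩
  Σ< (suc n) (λ k → sgn (suc n ∸ k) * f k) + 0ℤ
    ≡⟨ +-identityʳ _ ⟩
  Σ< (suc n) (λ k → sgn (suc n ∸ k) * f k)
    ≡⟨ Σ<-cong (suc n) (λ {k} k<1+n → flip-sign (ℕ.s≤s⁻¹ k<1+n)) ⟩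
  Σ< (suc n) (λ k → - (sgn (n ∸ k) * f k))
    ≡⟨ Σ<-neg (suc n) (λ k → sgn (n ∸ k) * f k) ⟩
  - Σ± n f ∎
  where
  last≡0 : sgn (n ∸ n) * f (suc n) ≡ 0ℤ
  last≡0 = trans (cong (sgn (n ∸ n) *_) f[1+n]≡0) (*-zeroʳ (sgn (n ∸ n)))
  flip-sign : ∀ {k} → k ℕ.≤ n → sgn (suc n ∸ k) * f k ≡ - (sgn (n ∸ k) * f k)
  flip-sign {k} k≤n = trans (cong (_* f k) (sgn-suc-∸ k≤n)) (sym (neg-distribˡ-* (sgn (n ∸ k)) (f k)))

[1+n]Ck*[1+n∸k]≡[1+n]*nCk : ∀ n k → (suc n C k) ℕ.* (suc n ∸ k) ≡ suc n ℕ.* (n C k)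
[1+n]Ck*[1+n∸k]≡[1+n]*nCk n       zero    = ℕₚ.*-comm 1 (suc n)
[1+n]Ck*[1+n∸k]≡[1+n]*nCk zero    (suc k) = trans (cong ((1 C suc k) ℕ.*_) (ℕₚ.0∸n≡0 k)) (ℕₚ.*-zeroʳ (1 C suc k))
[1+n]Ck*[1+n∸k]≡[1+n]*nCk (suc n) (suc k) = begin
  (suc (suc n) C suc k) ℕ.* (suc n ∸ k)
    ≡⟨ cong (ℕ._* (suc n ∸ k)) (sym (nCk+nC[k+1]≡[n+1]C[k+1] (suc n) k)) ⟩
  ((suc n C k) ℕ.+ c) ℕ.* (suc n ∸ k)
    ≡⟨ ℕₚ.*-distribʳ-+ (suc n ∸ k) (suc n C k) c ⟩
  (suc n C k) ℕ.* (suc n ∸ k) ℕ.+ c ℕ.* (suc n ∸ k)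
    ≡⟨ cong₂ ℕ._+_ ([1+n]Ck*[1+n∸k]≡[1+n]*nCk n k) c*[1+n∸k]≡c*[n∸k]+c ⟩
  suc n ℕ.* (n C k) ℕ.+ (c ℕ.* (n ∸ k) ℕ.+ c)
    ≡⟨ cong (λ x → suc n ℕ.* (n C k) ℕ.+ (x ℕ.+ c)) ([1+n]Ck*[1+n∸k]≡[1+n]*nCk n (suc k)) ⟩
  suc n ℕ.* (n C k) ℕ.+ (suc n ℕ.* (n C suc k) ℕ.+ c)
    ≡⟨ ℕₚ.+-assoc (suc n ℕ.* (n C k)) (suc n ℕ.* (n C suc k)) c ⟨
  suc n ℕ.* (n C k) ℕ.+ suc n ℕ.* (n C suc k) ℕ.+ c
    ≡⟨ cong (ℕ._+ c) (ℕₚ.*-distribˡ-+ (suc n) (n C k) (n C suc k)) ⟨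
  suc n ℕ.* ((n C k) ℕ.+ (n C suc k)) ℕ.+ c
    ≡⟨ cong (λ x → suc n ℕ.* x ℕ.+ c) (nCk+nC[k+1]≡[n+1]C[k+1] n k) ⟩
  suc n ℕ.* c ℕ.+ c
    ≡⟨ ℕₚ.+-comm (suc n ℕ.* c) c ⟩
  suc (suc n) ℕ.* c ∎
  where
  c = suc n C suc k
  c*[1+n∸k]≡c*[n∸k]+c : c ℕ.* (suc n ∸ k) ≡ c ℕ.* (n ∸ k) ℕ.+ c
  c*[1+n∸k]≡c*[n∸k]+c with ℕₚ.≤-<-connex k n
  ... | inj₁ k≤n = begin
    c ℕ.* (suc n ∸ k)          ≡⟨ cong (c ℕ.*_) (ℕₚ.+-∸-assoc 1 k≤n) ⟩
    c ℕ.* suc (n ∸ k)          ≡⟨ ℕₚ.*-suc c (n ∸ k) ⟩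
    c ℕ.+ c ℕ.* (n ∸ k)        ≡⟨ ℕₚ.+-comm c (c ℕ.* (n ∸ k)) ⟩
    c ℕ.* (n ∸ k) ℕ.+ c        ∎
  ... | inj₂ n<k rewrite k>n⇒nCk≡0 (ℕ.s≤s n<k) = refl

[1+k]*nC[1+k]+k*nCk≡n*nCk : ∀ n k → suc k ℕ.* (n C suc k) ℕ.+ k ℕ.* (n C k) ≡ n ℕ.* (n C k)
[1+k]*nC[1+k]+k*nCk≡n*nCk zero    zero    = refl
[1+k]*nC[1+k]+k*nCk≡n*nCk zero    (suc k) = cong₂ ℕ._+_ (ℕₚ.*-zeroʳ (suc (suc k))) (ℕₚ.*-zeroʳ (suc k))
[1+k]*nC[1+k]+k*nCk≡n*nCk (suc n) zero    = begin
  1 ℕ.* (suc n C 1) ℕ.+ 0  ≡⟨ ℕₚ.+-identityʳ _ ⟩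
  1 ℕ.* (suc n C 1)        ≡⟨ ℕₚ.*-identityˡ _ ⟩
  suc n C 1                ≡⟨ nC1≡n (suc n) ⟩
  suc n                    ≡⟨ ℕₚ.*-identityʳ (suc n) ⟨
  suc n ℕ.* 1              ∎
[1+k]*nC[1+k]+k*nCk≡n*nCk (suc n) (suc k) = begin
  suc (suc k) ℕ.* (suc n C suc (suc k)) ℕ.+ suc k ℕ.* (suc n C suc k)
    ≡⟨ cong₂ (λ x y → suc (suc k) ℕ.* x ℕ.+ suc k ℕ.* y)
             (nCk+nC[k+1]≡[n+1]C[k+1] n (suc k)) (nCk+nC[k+1]≡[n+1]C[k+1] n k) ⟨
  suc (suc k) ℕ.* (b ℕ.+ c) ℕ.+ suc k ℕ.* (a ℕ.+ b)
    ≡⟨ regroup k a b c ⟩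
  (suc (suc k) ℕ.* c ℕ.+ suc k ℕ.* b) ℕ.+ (suc k ℕ.* b ℕ.+ k ℕ.* a) ℕ.+ a ℕ.+ b
    ≡⟨ cong₂ (λ x y → x ℕ.+ y ℕ.+ a ℕ.+ b)
             ([1+k]*nC[1+k]+k*nCk≡n*nCk n (suc k)) ([1+k]*nC[1+k]+k*nCk≡n*nCk n k) ⟩
  n ℕ.* b ℕ.+ n ℕ.* a ℕ.+ a ℕ.+ b
    ≡⟨ collect n a b ⟩
  suc n ℕ.* (a ℕ.+ b)
    ≡⟨ cong (suc n ℕ.*_) (nCk+nC[k+1]≡[n+1]C[k+1] n k) ⟩
  suc n ℕ.* (suc n C suc k) ∎
  where
  a = n C k
  b = n C suc k
  c = n C suc (suc k)
  regroup : ∀ k a b c → suc (suc k) ℕ.* (b ℕ.+ c) ℕ.+ suc k ℕ.* (a ℕ.+ b)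
                      ≡ (suc (suc k) ℕ.* c ℕ.+ suc k ℕ.* b) ℕ.+ (suc k ℕ.* b ℕ.+ k ℕ.* a) ℕ.+ a ℕ.+ b
  regroup = ℕ-Solver.solve-∀
  collect : ∀ n a b → n ℕ.* b ℕ.+ n ℕ.* a ℕ.+ a ℕ.+ b ≡ suc n ℕ.* (a ℕ.+ b)
  collect = ℕ-Solver.solve-∀

stirling : ℕ → ℕ → ℕ
stirling zero    zero    = 1
stirling zero    (suc k) = 0
stirling (suc n) zero    = 0
stirling (suc n) (suc k) = stirling n k ℕ.+ suc k ℕ.* stirling n (suc k)

stirling-vanishing : ∀ {n k} → n ℕ.< k → stirling n k ≡ 0
stirling-vanishing {zero}  {suc k} _ = refl
stirling-vanishing {suc n} {suc k} (s≤s n<k)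
  rewrite stirling-vanishing n<k | stirling-vanishing (ℕₚ.m<n⇒m<1+n n<k) = ℕₚ.*-zeroʳ (suc k)

+stirling-suc : ∀ n k → + stirling (suc n) (suc k) ≡ + stirling n k + + suc k * + stirling n (suc k)
+stirling-suc n k = trans (pos-+ (stirling n k) _) (cong (_+_ (+ stirling n k)) (pos-* (suc k) _))

Δ : ℕ → (ℕ → ℕ) → ℤ
Δ k f = Σ< (suc k) (λ i → sgn i * + ((k C i) ℕ.* f (k ∸ i)))

Δ-∘suc : ∀ k f → Σ< (suc (suc k)) (λ i → sgn i * + ((k C i) ℕ.* f (suc k ∸ i))) ≡ Δ k (f ∘ suc)
Δ-∘suc k f = begin
  Σ< (suc (suc k)) u
    ≡⟨ Σ<-snoc (suc k) u ⟩
  Σ< (suc k) u + sgn (suc k) * + ((k C suc k) ℕ.* f (k ∸ k))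
    ≡⟨ cong (λ x → Σ< (suc k) u + sgn (suc k) * + (x ℕ.* f (k ∸ k))) (k>n⇒nCk≡0 (ℕₚ.n<1+n k)) ⟩
  Σ< (suc k) u + sgn (suc k) * 0ℤ
    ≡⟨ cong (_+_ (Σ< (suc k) u)) (*-zeroʳ (sgn (suc k))) ⟩
  Σ< (suc k) u + 0ℤ
    ≡⟨ +-identityʳ (Σ< (suc k) u) ⟩
  Σ< (suc k) u
    ≡⟨ Σ<-cong (suc k) (λ {i} i<1+k → cong (λ m → sgn i * + ((k C i) ℕ.* f m)) (ℕₚ.+-∸-assoc 1 (ℕ.s≤s⁻¹ i<1+k))) ⟩
  Δ k (f ∘ suc) ∎
  where
  u : ℕ → ℤ
  u i = sgn i * + ((k C i) ℕ.* f (suc k ∸ i))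

Δ-suc : ∀ k f → Δ (suc k) f ≡ Δ k (f ∘ suc) - Δ k f
Δ-suc k f = begin
  u 0 + Σ< (suc k) (λ j → - sgn j * + ((suc k C suc j) ℕ.* f (k ∸ j)))
    ≡⟨ cong (_+_ (u 0)) (Σ<-cong (suc k) (λ {j} _ → pascal-split j)) ⟩
  u 0 + Σ< (suc k) (λ j → u (suc j) + - v j)
    ≡⟨ cong (_+_ (u 0)) (Σ<-+ (suc k) (u ∘ suc) (λ j → - v j)) ⟩
  u 0 + (Σ< (suc k) (u ∘ suc) + Σ< (suc k) (λ j → - v j))
    ≡⟨ +-assoc (u 0) (Σ< (suc k) (u ∘ suc)) _ ⟨
  Σ< (suc (suc k)) u + Σ< (suc k) (λ j → - v j)
    ≡⟨ cong₂ _+_ (Δ-∘suc k f) (Σ<-neg (suc k) v) ⟩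
  Δ k (f ∘ suc) - Δ k f ∎
  where
  u v : ℕ → ℤ
  u i = sgn i * + ((k C i) ℕ.* f (suc k ∸ i))
  v j = sgn j * + ((k C j) ℕ.* f (k ∸ j))
  pascal-split : ∀ j → - sgn j * + ((suc k C suc j) ℕ.* f (k ∸ j)) ≡ u (suc j) + - v j
  pascal-split j = begin
    - sgn j * + ((suc k C suc j) ℕ.* y)
      ≡⟨ cong (λ x → - sgn j * + (x ℕ.* y)) (nCk+nC[k+1]≡[n+1]C[k+1] k j) ⟨
    - sgn j * + (((k C j) ℕ.+ (k C suc j)) ℕ.* y)
      ≡⟨ cong (λ x → - sgn j * + x) (ℕₚ.*-distribʳ-+ y (k C j) (k C suc j)) ⟩
    - sgn j * + ((k C j) ℕ.* y ℕ.+ (k C suc j) ℕ.* y)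
      ≡⟨ cong (- sgn j *_) (pos-+ ((k C j) ℕ.* y) _) ⟩
    - sgn j * (+ ((k C j) ℕ.* y) + + ((k C suc j) ℕ.* y))
      ≡⟨ distrib-neg (sgn j) _ _ ⟩
    - sgn j * + ((k C suc j) ℕ.* y) + - (sgn j * + ((k C j) ℕ.* y)) ∎
    where
    y = f (k ∸ j)
    distrib-neg : ∀ σ a b → - σ * (a + b) ≡ - σ * b + - (σ * a)
    distrib-neg = solve-∀

Δ-suc-* : ∀ k g → Δ (suc k) (λ x → x ℕ.* g x) ≡ + suc k * Δ k (g ∘ suc)
Δ-suc-* k g = begin
  Δ (suc k) (λ x → x ℕ.* g x)
    ≡⟨ sum-cong-≗ {suc (suc k)} (absorb ∘ toℕ) ⟩
  Σ< (suc (suc k)) (λ i → + suc k * (sgn i * + ((k C i) ℕ.* g (suc k ∸ i))))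
    ≡⟨ Σ<-*ˡ (suc (suc k)) (+ suc k) (λ i → sgn i * + ((k C i) ℕ.* g (suc k ∸ i))) ⟩
  + suc k * Σ< (suc (suc k)) (λ i → sgn i * + ((k C i) ℕ.* g (suc k ∸ i)))
    ≡⟨ cong (+ suc k *_) (Δ-∘suc k g) ⟩
  + suc k * Δ k (g ∘ suc) ∎
  where
  absorb : ∀ i → sgn i * + ((suc k C i) ℕ.* ((suc k ∸ i) ℕ.* g (suc k ∸ i)))
               ≡ + suc k * (sgn i * + ((k C i) ℕ.* g (suc k ∸ i)))
  absorb i = begin
    sgn i * + ((suc k C i) ℕ.* ((suc k ∸ i) ℕ.* y))
      ≡⟨ cong (λ x → sgn i * + x) (ℕₚ.*-assoc (suc k C i) (suc k ∸ i) y) ⟨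
    sgn i * + ((suc k C i) ℕ.* (suc k ∸ i) ℕ.* y)
      ≡⟨ cong (λ x → sgn i * + (x ℕ.* y)) ([1+n]Ck*[1+n∸k]≡[1+n]*nCk k i) ⟩
    sgn i * + (suc k ℕ.* (k C i) ℕ.* y)
      ≡⟨ cong (λ x → sgn i * x) (trans (cong +_ (ℕₚ.*-assoc (suc k) (k C i) y)) (pos-* (suc k) _)) ⟩
    sgn i * (+ suc k * + ((k C i) ℕ.* y))
      ≡⟨ x∙yz≈y∙xz (sgn i) (+ suc k) _ ⟩
    + suc k * (sgn i * + ((k C i) ℕ.* y)) ∎
    where
    y = g (suc k ∸ i)

Δ-^≡!*stirling : ∀ n k → Δ k (ℕ._^ n) ≡ + (k ! ℕ.* stirling n k)
Δ-^≡!*stirling zero    zero    = refl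
Δ-^≡!*stirling zero    (suc k) = begin
  Δ (suc k) (ℕ._^ 0)            ≡⟨ Δ-suc k (ℕ._^ 0) ⟩
  Δ k (ℕ._^ 0) - Δ k (ℕ._^ 0)   ≡⟨ +-inverseʳ (Δ k (ℕ._^ 0)) ⟩
  0ℤ                            ≡⟨ cong +_ (ℕₚ.*-zeroʳ (suc k !)) ⟨
  + (suc k ! ℕ.* 0)             ∎
Δ-^≡!*stirling (suc n) zero    = refl
Δ-^≡!*stirling (suc n) (suc k) = begin
  Δ (suc k) (ℕ._^ suc n)
    ≡⟨ Δ-suc-* k (ℕ._^ n) ⟩
  + suc k * Δ k ((ℕ._^ n) ∘ suc)
    ≡⟨ cong (+ suc k *_) (trans (cong (_+ Δ k (ℕ._^ n)) (Δ-suc k (ℕ._^ n))) (minus-plus _ _)) ⟨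
  + suc k * (Δ (suc k) (ℕ._^ n) + Δ k (ℕ._^ n))
    ≡⟨ cong₂ (λ x y → + suc k * (x + y)) (Δ-^≡!*stirling n (suc k)) (Δ-^≡!*stirling n k) ⟩
  + suc k * (+ (suc k ! ℕ.* stirling n (suc k)) + + (k ! ℕ.* stirling n k))
    ≡⟨ trans (pos-* (suc k) _) (cong (+ suc k *_) (pos-+ (suc k ! ℕ.* stirling n (suc k)) _)) ⟨
  + (suc k ℕ.* (suc k ! ℕ.* stirling n (suc k) ℕ.+ k ! ℕ.* stirling n k))
    ≡⟨ cong +_ (factor k (k !) (stirling n k) (stirling n (suc k))) ⟩
  + (suc k ! ℕ.* stirling (suc n) (suc k)) ∎
  where
  minus-plus : ∀ a b → a - b + b ≡ a
  minus-plus = solve-∀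
  factor : ∀ k f a b → suc k ℕ.* (suc k ℕ.* f ℕ.* b ℕ.+ f ℕ.* a) ≡ suc k ℕ.* f ℕ.* (a ℕ.+ suc k ℕ.* b)
  factor = ℕ-Solver.solve-∀

S≡stirling : ∀ n k → S n k ≡ + stirling n k
S≡stirling n k = begin
  S n k
    ≡⟨ cong (_/ℕ k !) (trans (ΣZ-from-0 k (λ i → sgn i * + ((k C i) ℕ.* ((k ∸ i) ℕ.^ n)))) (Δ-^≡!*stirling n k)) ⟩
  + (k ! ℕ.* stirling n k) /ℕ k !   ≡⟨ cong (λ m → + (m ℕ./ k !)) (ℕₚ.*-comm (k !) (stirling n k)) ⟩
  + (stirling n k ℕ.* k ! ℕ./ k !)  ≡⟨ cong +_ (m*n/n≡m (stirling n k) (k !)) ⟩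
  + stirling n k                    ∎
  where instance _ = k !≢0

lah : ℕ → ℕ → ℕ
lah zero    zero    = 1
lah zero    (suc l) = 0
lah (suc k) zero    = 0
lah (suc k) (suc l) = lah k l ℕ.+ (k ℕ.+ suc l) ℕ.* lah k (suc l)

lah-vanishing : ∀ {k l} → k ℕ.< l → lah k l ≡ 0
lah-vanishing {zero}  {suc l} _ = refl
lah-vanishing {suc k} {suc l} (s≤s k<l)
  rewrite lah-vanishing k<l | lah-vanishing (ℕₚ.m<n⇒m<1+n k<l) = ℕₚ.*-zeroʳ (k ℕ.+ suc l)

+lah-suc : ∀ k l → + lah (suc k) (suc l) ≡ + lah k l + (+ k + + suc l) * + lah k (suc l)
+lah-suc k l = trans (pos-+ (lah k l) _) (cong (_+_ (+ lah k l))
  (trans (pos-* (k ℕ.+ suc l) _) (cong (_* + lah k (suc l)) (pos-+ k (suc l)))))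

lah[1+k][1+l]*[1+l]!≡kCl*[1+k]! : ∀ k l → lah (suc k) (suc l) ℕ.* suc l ! ≡ (k C l) ℕ.* suc k !
lah[1+k][1+l]*[1+l]!≡kCl*[1+k]! zero    zero    = refl
lah[1+k][1+l]*[1+l]!≡kCl*[1+k]! zero    (suc l) = cong (ℕ._* suc (suc l) !) (ℕₚ.*-zeroʳ (suc (suc l)))
lah[1+k][1+l]*[1+l]!≡kCl*[1+k]! (suc k) zero    = begin
  (suc k ℕ.+ 1) ℕ.* lah (suc k) 1 ℕ.* 1  ≡⟨ ℕₚ.*-assoc (suc k ℕ.+ 1) (lah (suc k) 1) 1 ⟩
  (suc k ℕ.+ 1) ℕ.* (lah (suc k) 1 ℕ.* 1) ≡⟨ cong ((suc k ℕ.+ 1) ℕ.*_) (lah[1+k][1+l]*[1+l]!≡kCl*[1+k]! k 0) ⟩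
  (suc k ℕ.+ 1) ℕ.* (1 ℕ.* suc k !)       ≡⟨ unfold-! k (suc k !) ⟩
  1 ℕ.* suc (suc k) !                     ∎
  where
  unfold-! : ∀ k f → (suc k ℕ.+ 1) ℕ.* (1 ℕ.* f) ≡ 1 ℕ.* (suc (suc k) ℕ.* f)
  unfold-! = ℕ-Solver.solve-∀
lah[1+k][1+l]*[1+l]!≡kCl*[1+k]! (suc k) (suc l) = begin
  (lah (suc k) (suc l) ℕ.+ (suc k ℕ.+ suc (suc l)) ℕ.* lah (suc k) (suc (suc l))) ℕ.* (suc (suc l) ℕ.* suc l !)
    ≡⟨ expand (lah (suc k) (suc l)) (lah (suc k) (suc (suc l))) (suc k ℕ.+ suc (suc l)) (suc l !) l ⟩
  suc (suc l) ℕ.* (lah (suc k) (suc l) ℕ.* suc l !)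
    ℕ.+ (suc k ℕ.+ suc (suc l)) ℕ.* (lah (suc k) (suc (suc l)) ℕ.* suc (suc l) !)
    ≡⟨ cong₂ (λ x y → suc (suc l) ℕ.* x ℕ.+ (suc k ℕ.+ suc (suc l)) ℕ.* y)
             (lah[1+k][1+l]*[1+l]!≡kCl*[1+k]! k l) (lah[1+k][1+l]*[1+l]!≡kCl*[1+k]! k (suc l)) ⟩
  suc (suc l) ℕ.* (a ℕ.* suc k !) ℕ.+ (suc k ℕ.+ suc (suc l)) ℕ.* (b ℕ.* suc k !)
    ≡⟨ regroup k l a b (suc k !) ⟩
  (2 ℕ.* a ℕ.+ suc (suc k) ℕ.* b ℕ.+ (suc l ℕ.* b ℕ.+ l ℕ.* a)) ℕ.* suc k !
    ≡⟨ cong (λ x → (2 ℕ.* a ℕ.+ suc (suc k) ℕ.* b ℕ.+ x) ℕ.* suc k !) ([1+k]*nC[1+k]+k*nCk≡n*nCk k l) ⟩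
  (2 ℕ.* a ℕ.+ suc (suc k) ℕ.* b ℕ.+ k ℕ.* a) ℕ.* suc k !
    ≡⟨ collect k a b (suc k !) ⟩
  (a ℕ.+ b) ℕ.* suc (suc k) !
    ≡⟨ cong (ℕ._* suc (suc k) !) (nCk+nC[k+1]≡[n+1]C[k+1] k l) ⟩
  (suc k C suc l) ℕ.* suc (suc k) ! ∎
  where
  a = k C l
  b = k C suc l
  expand : ∀ x y m f l → (x ℕ.+ m ℕ.* y) ℕ.* (suc (suc l) ℕ.* f)
                       ≡ suc (suc l) ℕ.* (x ℕ.* f) ℕ.+ m ℕ.* (y ℕ.* (suc (suc l) ℕ.* f))
  expand = ℕ-Solver.solve-∀
  regroup : ∀ k l a b f → suc (suc l) ℕ.* (a ℕ.* f) ℕ.+ (suc k ℕ.+ suc (suc l)) ℕ.* (b ℕ.* f)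
                        ≡ (2 ℕ.* a ℕ.+ suc (suc k) ℕ.* b ℕ.+ (suc l ℕ.* b ℕ.+ l ℕ.* a)) ℕ.* f
  regroup = ℕ-Solver.solve-∀
  collect : ∀ k a b f → (2 ℕ.* a ℕ.+ suc (suc k) ℕ.* b ℕ.+ k ℕ.* a) ℕ.* f ≡ (a ℕ.+ b) ℕ.* (suc (suc k) ℕ.* f)
  collect = ℕ-Solver.solve-∀

L≡lah : ∀ k l → L (suc k) (suc l) ≡ lah (suc k) (suc l)
L≡lah k l = begin
  ((k C l) ℕ.* suc k !) ℕ./ suc l !              ≡⟨ cong (ℕ._/ suc l !) (lah[1+k][1+l]*[1+l]!≡kCl*[1+k]! k l) ⟨
  (lah (suc k) (suc l) ℕ.* suc l !) ℕ./ suc l !  ≡⟨ m*n/n≡m (lah (suc k) (suc l)) (suc l !) ⟩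
  lah (suc k) (suc l)                            ∎
  where instance _ = suc l !≢0

lahRowSum : ℕ → ℤ
lahRowSum k = Σ< (suc k) (λ l → + lah k l)

ΣZ-L≡lahRowSum : ∀ k → ΣZ 1 (suc k) (λ l → + L (suc k) l) ≡ lahRowSum (suc k)
ΣZ-L≡lahRowSum k = begin
  ΣZ 1 (suc k) (λ l → + L (suc k) l)           ≡⟨ ΣZ-from-1 (suc k) (λ l → + L (suc k) l) ⟩
  Σ< (suc k) (λ l → + L (suc k) (suc l))       ≡⟨ sum-cong-≗ {suc k} (cong +_ ∘ L≡lah k ∘ toℕ) ⟩
  Σ< (suc k) (λ l → + lah (suc k) (suc l))     ≡⟨ +-identityˡ _ ⟨
  lahRowSum (suc k)                            ∎

stirling-lah-inversion : ∀ n l → Σ± n (λ k → + stirling n k * + lah k l) ≡ + stirling n l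
stirling-lah-inversion zero    zero    = refl
stirling-lah-inversion zero    (suc l) = refl
stirling-lah-inversion (suc n) zero    = Σ<-vanishing (suc (suc n)) vanish
  where
  vanish : ∀ k → sgn (suc n ∸ k) * (+ stirling (suc n) k * + lah k 0) ≡ 0ℤ
  vanish zero    = *-zeroʳ (sgn (suc n))
  vanish (suc k) = trans (cong (sgn (n ∸ k) *_) (*-zeroʳ (+ stirling (suc n) (suc k)))) (*-zeroʳ (sgn (n ∸ k)))
stirling-lah-inversion (suc n) (suc l) = begin
  Σ± (suc n) (λ k → + stirling (suc n) k * + lah k (suc l))
    ≡⟨ Σ±-vanishing-head n (λ k → + stirling (suc n) k * + lah k (suc l)) refl ⟩
  Σ± n (λ k → + stirling (suc n) (suc k) * + lah (suc k) (suc l))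
    ≡⟨ Σ±-cong n (λ {k} _ → split k) ⟩
  Σ± n (λ k → (a k + + suc l * b k + c k) + c (suc k))
    ≡⟨ Σ±-+ n (λ k → a k + + suc l * b k + c k) (c ∘ suc) ⟩
  Σ± n (λ k → a k + + suc l * b k + c k) + Σ± n (c ∘ suc)
    ≡⟨ cong₂ _+_ linearity shifted-c ⟩
  Σ± n a + + suc l * Σ± n b + Σ± n c + - Σ± n c
    ≡⟨ cancel (Σ± n a + + suc l * Σ± n b) (Σ± n c) ⟩
  Σ± n a + + suc l * Σ± n b
    ≡⟨ cong₂ (λ x y → x + + suc l * y) (stirling-lah-inversion n l) (stirling-lah-inversion n (suc l)) ⟩
  + stirling n l + + suc l * + stirling n (suc l)
    ≡⟨ +stirling-suc n l ⟨
  + stirling (suc n) (suc l) ∎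
  where
  a b c : ℕ → ℤ
  a k = + stirling n k * + lah k l
  b k = + stirling n k * + lah k (suc l)
  c k = + k * b k
  linearity : Σ± n (λ k → a k + + suc l * b k + c k) ≡ Σ± n a + + suc l * Σ± n b + Σ± n c
  linearity = begin
    Σ± n (λ k → a k + + suc l * b k + c k)        ≡⟨ Σ±-+ n (λ k → a k + + suc l * b k) c ⟩
    Σ± n (λ k → a k + + suc l * b k) + Σ± n c     ≡⟨ cong (_+ Σ± n c) (Σ±-+ n a (λ k → + suc l * b k)) ⟩
    Σ± n a + Σ± n (λ k → + suc l * b k) + Σ± n c  ≡⟨ cong (λ x → Σ± n a + x + Σ± n c) (Σ±-*ˡ n (+ suc l) b) ⟩
    Σ± n a + + suc l * Σ± n b + Σ± n c            ∎
  c[1+n]≡0 : c (suc n) ≡ 0ℤ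
  c[1+n]≡0 = trans (cong (λ x → + suc n * (+ x * + lah (suc n) (suc l))) (stirling-vanishing (ℕₚ.n<1+n n)))
                   (*-zeroʳ (+ suc n))
  -- The terms k S(n,k) L(k,l+1) produced by the two recurrences occur once at index k and once,
  -- with the opposite sign, at index k+1.
  shifted-c : Σ± n (c ∘ suc) ≡ - Σ± n c
  shifted-c = trans (sym (Σ±-vanishing-head n c refl)) (Σ±-vanishing-last n c c[1+n]≡0)
  cancel : ∀ x y → x + y + - y ≡ x
  cancel = solve-∀
  split : ∀ k → + stirling (suc n) (suc k) * + lah (suc k) (suc l) ≡ (a k + + suc l * b k + c k) + c (suc k)
  split k = begin
    + stirling (suc n) (suc k) * Λ
      ≡⟨ cong (_* Λ) (+stirling-suc n k) ⟩
    (+ stirling n k + + suc k * + stirling n (suc k)) * Λ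
      ≡⟨ distribʳ (+ stirling n k) (+ suc k) (+ stirling n (suc k)) Λ ⟩
    + stirling n k * Λ + c (suc k)
      ≡⟨ cong (λ x → + stirling n k * x + c (suc k)) (+lah-suc k l) ⟩
    + stirling n k * (+ lah k l + (+ k + + suc l) * + lah k (suc l)) + c (suc k)
      ≡⟨ cong (_+ c (suc k)) (distribˡ (+ stirling n k) (+ lah k l) (+ k) (+ suc l) (+ lah k (suc l))) ⟩
    (a k + + suc l * b k + c k) + c (suc k) ∎
    where
    Λ = + lah (suc k) (suc l)
    distribʳ : ∀ s₀ m s₁ x → (s₀ + m * s₁) * x ≡ s₀ * x + m * (s₁ * x)
    distribʳ = solve-∀
    distribˡ : ∀ s x m j y → s * (x + (m + j) * y) ≡ s * x + j * (s * y) + m * (s * y)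
    distribˡ = solve-∀

Bell≡Σ±stirling*lahRowSum : ∀ n → Bell n ≡ Σ± n (λ k → + stirling n k * lahRowSum k)
Bell≡Σ±stirling*lahRowSum n = begin
  Bell n
    ≡⟨ ΣZ-from-0 n (S n) ⟩
  Σ< (suc n) (S n)
    ≡⟨ sum-cong-≗ {suc n} (λ l → trans (S≡stirling n (toℕ l)) (sym (stirling-lah-inversion n (toℕ l)))) ⟩
  Σ< (suc n) (λ l → Σ± n (λ k → + stirling n k * + lah k l))
    ≡⟨ Σ<-Σ±-comm (suc n) n (λ k l → + stirling n k * + lah k l) ⟩
  Σ± n (λ k → Σ< (suc n) (λ l → + stirling n k * + lah k l))
    ≡⟨ Σ±-cong n row ⟩
  Σ± n (λ k → + stirling n k * lahRowSum k) ∎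
  where
  row : ∀ {k} → k ℕ.≤ n → Σ< (suc n) (λ l → + stirling n k * + lah k l) ≡ + stirling n k * lahRowSum k
  row {k} k≤n = trans (Σ<-*ˡ (suc n) (+ stirling n k) (λ l → + lah k l))
    (cong (+ stirling n k *_) (Σ<-vanishing-tail (λ l → + lah k l) (s≤s k≤n) (λ k<l → cong +_ (lah-vanishing k<l))))

theorem1 : (n : ℕ) → Bell (suc n) ≡
    ΣZ 1 (suc n) (λ k → sgn (suc n ∸ k) * (ΣZ 1 k (λ l → + L k l) * S (suc n) k))
theorem1 n = begin
  Bell (suc n)
    ≡⟨ Bell≡Σ±stirling*lahRowSum (suc n) ⟩
  Σ± (suc n) (λ k → + stirling (suc n) k * lahRowSum k)
    ≡⟨ Σ±-vanishing-head n (λ k → + stirling (suc n) k * lahRowSum k) refl ⟩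
  Σ± n (λ k → + stirling (suc n) (suc k) * lahRowSum (suc k))
    ≡⟨ Σ±-cong n (λ {k} _ → trans (*-comm (+ stirling (suc n) (suc k)) (lahRowSum (suc k)))
         (cong₂ _*_ (sym (ΣZ-L≡lahRowSum k)) (sym (S≡stirling (suc n) (suc k))))) ⟩
  Σ< (suc n) (F ∘ suc)
    ≡⟨ ΣZ-from-1 (suc n) F ⟨
  ΣZ 1 (suc n) F ∎
  where
  F : ℕ → ℤ
  F k = sgn (suc n ∸ k) * (ΣZ 1 k (λ l → + L k l) * S (suc n) k)
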